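{- In the setting described in the context, for every $i\in[m]$, \[ f_i+2c_i\ \ge\ f_{i-1}+2c_{i-1}+1 . \]
   Context: Let $s,t$ be positive integers. For a graph $G$ on vertex set $V$ with $|V|=s+t+1$, an edge $e$ is erasable in $G$ if there is a partition $(V^1,V^2,\{v\})$ of $V$ with $|V^1|=s$, $|V^2|=t$ such that $e$ is the only edge of $G$ between $V^1$ and $V^2$; $v$ is called the closed vertex. A graph is erasable if its edges can be removed one at a time, each removed edge being erasable in the current graph, until no edges remain. Fix a graph $G$ with the maximum number of edges among all erasable graphs on $s+t+1$ vertices, let $m=|E(G)|$, and fix an erase process: an ordering $e_1,\dots,e_m$ of $E(G)$ with graphs $G_0=G$, $G_i=G_{i-1}\setminus e_i$, such that $e_i$ is erasable in $G_{i-1}$, together with a fixed witness partition $(V_i^1,V_i^2,\{v_i\})$ for each $i$. Hypergraphs $H_0,\dots,H_m$ on vertex set $V$ are defined as follows. The hyperedges of $H_0$ are the vertex sets of the connected components of $G_0$ having at least two vertices. For $i\in[m]$, $H_i$ is obtained from $H_{i-1}$ by: (1) (edge-operation) taking the unique hyperedge $F$ of $H_{i-1}$ containing both endpoints of $e_i$ and replacing it by the vertex sets of those connected components of $G_{i-1}[F]\setminus e_i$ that have more than one vertex (so $F$ is unchanged if $G_{i-1}[F]\setminus e_i$ is connected); then (2) (vertex-operation) for every hyperedge $F$ of the resulting hypergraph containing $v_i$, letting $F_1,\dots,F_h$ be the vertex sets of the connected components of $G_i[F\setminus\{v_i\}]$ and replacing $F$ by $F_1\cup\{v_i\},\dots,F_h\cup\{v_i\}$.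 Let $f_i$ be the number of hyperedges of $H_i$ and $c_i$ the number of connected components of $H_i$, where each vertex lying in no hyperedge counts as a connected component. -}

module Defs where

open import Data.Nat using (ℕ; zero; suc; _+_; _≤_; _<ᵇ_)
open import Data.Fin using (Fin; toℕ; _≟_)
open import Data.Bool using (Bool; true; false; _∧_; _∨_; not; if_then_else_)
open import Data.List using (List; []; _∷_; length; map; filterᵇ; concatMap; allFin; cartesianProduct)
open import Data.Bool.ListAction using (any)
open import Data.Product using (_×_; _,_; proj₁; proj₂; ∃-syntax)
open import Data.Sum using (_⊎_)
open import Relation.Nullary.Decidable using (⌊_⌋)
open import Relation.Binary.PropositionalEquality using (_≡_)

Graph : ℕ → Set
Graph n = Fin n → Fin n → Bool

Simple : ∀ {n} → Graph n → Set
Simple {n} G = (∀ (x y : Fin n) → G x y ≡ G y x) × (∀ (x : Fin n) → G x x ≡ false)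

_==_ : ∀ {n} → Fin n → Fin n → Bool
x == y = ⌊ x ≟ y ⌋

edgeCount : ∀ {n} → Graph n → ℕ
edgeCount {n} G =
  length (filterᵇ (λ p → (toℕ (proj₁ p) <ᵇ toℕ (proj₂ p)) ∧ G (proj₁ p) (proj₂ p))
                  (cartesianProduct (allFin n) (allFin n)))

removeEdge : ∀ {n} → Graph n → Fin n → Fin n → Graph n
removeEdge G a b x y = G x y ∧ not (((x == a) ∧ (y == b)) ∨ ((x == b) ∧ (y == a)))

size : ∀ {n} → (Fin n → Bool) → ℕ
size {n} S = length (filterᵇ S (allFin n))

-- the three classes of a partition (V¹, V², {v})
data Side : Set where
  side₁ side₂ closedSide : Side

isSide₁ : Side → Bool
isSide₁ side₁ = true
isSide₁ _ = false

isSide₂ : Side → Bool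
isSide₂ side₂ = true
isSide₂ _ = false

-- one step of an erase process: the erased edge {a,b}, the closed vertex v,
-- and the witness partition (part x tells in which class x lies)
record Step (n : ℕ) : Set where
  constructor step
  field
    a b  : Fin n
    v    : Fin n
    part : Fin n → Side

open Step public

ErasableBy : (s t : ℕ) → Graph (suc (s + t)) → Step (suc (s + t)) → Set
ErasableBy s t G st =
    (G (a st) (b st) ≡ true)
  × (part st (v st) ≡ closedSide)
  × (∀ x → part st x ≡ closedSide → x ≡ v st)
  × (size (λ x → isSide₁ (part st x)) ≡ s)
  × (size (λ x → isSide₂ (part st x)) ≡ t)
  × ((part st (a st) ≡ side₁ × part st (b st) ≡ side₂)
      ⊎ (part st (b st) ≡ side₁ × part st (a st) ≡ side₂))
  × (∀ x y → G x y ≡ true → part st x ≡ side₁ → part st y ≡ side₂ →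
        (x ≡ a st × y ≡ b st) ⊎ (x ≡ b st × y ≡ a st))

afterStep : ∀ {n} → Graph n → Step n → Graph n
afterStep G st = removeEdge G (a st) (b st)

EraseProcess : (s t : ℕ) → Graph (suc (s + t)) → List (Step (suc (s + t))) → Set
EraseProcess s t G [] = ∀ x y → G x y ≡ false
EraseProcess s t G (st ∷ sts) = ErasableBy s t G st × EraseProcess s t (afterStep G st) sts

Erasable : (s t : ℕ) → Graph (suc (s + t)) → Set
Erasable s t G = Simple G × ∃[ sts ] EraseProcess s t G sts

MaxErasable : (s t : ℕ) → Graph (suc (s + t)) → Set
MaxErasable s t G = Erasable s t G × (∀ G' → Erasable s t G' → edgeCount G' ≤ edgeCount G)

afterSteps : ∀ {n} → Graph n → List (Step n) → Graph n
afterSteps G [] = G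
afterSteps G (st ∷ sts) = afterSteps (afterStep G st) sts

reachWithin : ∀ {n} → Graph n → (Fin n → Bool) → ℕ → Fin n → Fin n → Bool
reachWithin G S zero u y = S u ∧ (u == y)
reachWithin {n} G S (suc k) u y =
  reachWithin G S k u y ∨ any (λ w → reachWithin G S k u w ∧ S y ∧ G w y) (allFin n)

-- u and y are connected in G[S] (walks of length ≤ n suffice on n vertices)
reach : ∀ {n} → Graph n → (Fin n → Bool) → Fin n → Fin n → Bool
reach {n} G S = reachWithin G S n

-- vertex sets of the connected components of G[S], one per component
-- (listed via the least vertex of each component)
components : ∀ {n} → Graph n → (Fin n → Bool) → List (Fin n → Bool)
components {n} G S =
  map (λ r x → reach G S r x)
      (filterᵇ (λ r → S r ∧ not (any (λ u → (toℕ u <ᵇ toℕ r) ∧ reach G S u r) (allFin n)))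
               (allFin n))

Hypergraph : ℕ → Set
Hypergraph n = List (Fin n → Bool)

allV : ∀ {n} → Fin n → Bool
allV _ = true

atLeastTwo : ∀ {n} → (Fin n → Bool) → Bool
atLeastTwo S = 1 <ᵇ size S

H₀ : ∀ {n} → Graph n → Hypergraph n
H₀ G = filterᵇ atLeastTwo (components G allV)

-- edge-operation: G' = G_{i-1} \ e_i = G_i ; the hyperedge F containing both
-- endpoints of e_i is replaced by the non-trivial components of G'[F]
edgeOp : ∀ {n} → Graph n → Fin n → Fin n → Hypergraph n → Hypergraph n
edgeOp G' a b H =
  concatMap (λ F → if F a ∧ F b then filterᵇ atLeastTwo (components G' F) else (F ∷ [])) H

-- vertex-operation for the closed vertex v (G' = G_i)
vertexOp : ∀ {n} → Graph n → Fin n → Hypergraph n → Hypergraph n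
vertexOp G' v H =
  concatMap (λ F → if F v
                   then map (λ C x → C x ∨ (x == v)) (components G' (λ x → F x ∧ not (x == v)))
                   else (F ∷ [])) H

hyperStep : ∀ {n} → Graph n → Step n → Hypergraph n → Hypergraph n
hyperStep G st H = vertexOp (afterStep G st) (v st) (edgeOp (afterStep G st) (a st) (b st) H)

hyperAfter : ∀ {n} → Graph n → Hypergraph n → List (Step n) → Hypergraph n
hyperAfter G H [] = H
hyperAfter G H (st ∷ sts) = hyperAfter (afterStep G st) (hyperStep G st H) sts

numEdges : ∀ {n} → Hypergraph n → ℕ
numEdges = length

-- number of connected components of a hypergraph (isolated vertices count):
-- components of the graph where x ~ y iff some hyperedge contains both
numComponents : ∀ {n} → Hypergraph n → ℕ
numComponents H = length (components (λ x y → any (λ F → F x ∧ F y) H) allV)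

{-# OPTIONS --safe #-}
module Submission where

-- Call a vertex set F closed in G if no path of G whose inner vertices avoid F joins two
-- distinct vertices of F. Along any erase process of a simple graph, H_i "tracks" G_i: every
-- hyperedge has at least two vertices, induces a connected subgraph of G_i and is closed, every
-- edge of G_i lies in a hyperedge, and two distinct vertices share at most one hyperedge. Both
-- operations preserve this for any erased edge ab and any vertex v, and it makes the components
-- of H_i exactly those of G_i. If ab is a bridge of G_{i-1}, then c grows by one while f drops
-- by at most one, since only the hyperedge containing a and b can vanish. Otherwise a and b stay
-- connected in G_i, by closedness inside one component K of G_i[F] for the hyperedge F ∋ a, b.
-- As ab was the only edge between V¹ and V², every path from a to b in G_i meets v_i, so the
-- vertex-operation cuts K into at least two hyperedges: f grows while c does not drop.

open import Defs
open import Data.Nat using (ℕ; zero; suc; _+_; _*_; _≤_; _<_; z≤n; s≤s; s≤s⁻¹; _<ᵇ_; _∸_)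
open import Data.Nat.Properties
  using (≤-refl; ≤-trans; ≤-reflexive; ≤-antisym; ≤-total; <⇒≱; <-cmp; ≤-<-trans; m≤n⇒m≤1+n;
         m≤n+m; +-mono-≤; +-monoˡ-≤; +-monoʳ-≤; *-monoʳ-≤; <ᵇ⇒<; <⇒<ᵇ; m∸n+n≡m; n≤0⇒n≡0;
         module ≤-Reasoning)
open import Data.Bool using (Bool; true; false; _∧_; _∨_; not; if_then_else_; T)
open import Data.Bool.Properties
  using (T-≡; ¬-not; ∨-zeroʳ; ∧-zeroʳ; ∨-comm; ∧-comm) renaming (_≟_ to _≟ᵇ_)
open import Data.Bool.ListAction using (any; or)
open import Data.Fin using (Fin; toℕ; _≟_)
import Data.Fin.Base as Fin
open import Data.Fin.Properties using (toℕ-injective; all?; ¬∀⟶∃¬)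
open import Data.Fin.Induction using (<-wellFounded)
open import Data.List using (List; []; _∷_; _++_; [_]; length; map; filterᵇ; concatMap; allFin)
open import Data.List.Properties
  using (length-++; length-map; length-tabulate; length-filter; filter-++; filter-none; filter-some; map-cong)
open import Data.List.Membership.Propositional using () renaming (_∈_ to _∈ˡ_)
open import Data.List.Membership.Propositional.Properties using (∈-allFin; ∈-filter⁻)
open import Data.List.Relation.Unary.All as All using (All; []; _∷_)
import Data.List.Relation.Unary.All.Properties as Allₚ
open import Data.List.Relation.Unary.Any as Any using (Any; here; there)
import Data.List.Relation.Unary.Any.Properties as Anyₚ
open import Data.List.Relation.Unary.AllPairs using ([]; _∷_)
open import Data.List.Relation.Unary.Unique.Propositional using (Unique)
import Data.List.Relation.Unary.Unique.Propositional.Properties as Uniqueₚ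
open import Data.Product using (_×_; _,_; proj₁; proj₂; ∃-syntax)
open import Data.Sum using (_⊎_; inj₁; inj₂)
import Data.Sum as Sum
open import Function using (_∘_; Equivalence)
open import Induction.WellFounded using (Acc; acc)
open import Data.Nat.Tactic.RingSolver using (solve-∀)
open import Relation.Nullary using (¬_; Dec; yes; no; contradiction)
open import Relation.Nullary.Decidable using (dec-true; dec-false; isYes≗does; toWitness; T?)
open import Relation.Binary.PropositionalEquality hiding ([_])
open import Relation.Binary.Definitions using (Tri; tri<; tri≈; tri>)

infix 4 _∈_ _∉_ _⊆_

_∈_ : ∀ {n} → Fin n → (Fin n → Bool) → Set
x ∈ S = S x ≡ true

_∉_ : ∀ {n} → Fin n → (Fin n → Bool) → Set
x ∉ S = S x ≡ false

_⊆_ : ∀ {n} → (Fin n → Bool) → (Fin n → Bool) → Set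
K ⊆ F = ∀ {x} → x ∈ K → x ∈ F

_∖_ : ∀ {n} → (Fin n → Bool) → Fin n → Fin n → Bool
(F ∖ v) x = F x ∧ not (x == v)

insert : ∀ {n} → Fin n → (Fin n → Bool) → Fin n → Bool
insert v C x = C x ∨ (x == v)

contains : ∀ {n} → Fin n → Fin n → (Fin n → Bool) → Bool
contains x y F = F x ∧ F y

∧-true⁻ : ∀ {a b} → a ∧ b ≡ true → a ≡ true × b ≡ true
∧-true⁻ {true} {true} _ = refl , refl

∧-true⁺ : ∀ {a b} → a ≡ true → b ≡ true → a ∧ b ≡ true
∧-true⁺ refl refl = refl

∨-true⁻ : ∀ {a b} → a ∨ b ≡ true → a ≡ true ⊎ b ≡ true
∨-true⁻ {true}  _ = inj₁ refl
∨-true⁻ {false} e = inj₂ e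

∨-trueˡ : ∀ {a b} → a ≡ true → a ∨ b ≡ true
∨-trueˡ refl = refl

∨-trueʳ : ∀ {a b} → b ≡ true → a ∨ b ≡ true
∨-trueʳ {a} refl = ∨-zeroʳ a

∨-false⁻ : ∀ {a b} → a ∨ b ≡ false → a ≡ false × b ≡ false
∨-false⁻ {false} {false} _ = refl , refl

not-true⁻ : ∀ {a} → not a ≡ true → a ≡ false
not-true⁻ {false} _ = refl

not-true⁺ : ∀ {a} → a ≡ false → not a ≡ true
not-true⁺ refl = refl

true⇒≢false : ∀ {a} → a ≡ true → a ≢ false
true⇒≢false refl ()

==⇒≡ : ∀ {n} {x y : Fin n} → (x == y) ≡ true → x ≡ y
==⇒≡ {x = x} {y} e = toWitness {a? = x ≟ y} (Equivalence.from T-≡ e)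

==-refl : ∀ {n} (x : Fin n) → (x == x) ≡ true
==-refl x = trans (isYes≗does (x ≟ x)) (dec-true (x ≟ x) refl)

≢⇒==false : ∀ {n} {x y : Fin n} → x ≢ y → (x == y) ≡ false
≢⇒==false {x = x} {y} x≢y = trans (isYes≗does (x ≟ y)) (dec-false (x ≟ y) x≢y)

==-both : ∀ {n} {x y x′ y′ : Fin n} → (x == x′) ∧ (y == y′) ≡ true → x ≡ x′ × y ≡ y′
==-both {x = x} {x′ = x′} e =
  let x==x′ , y==y′ = ∧-true⁻ {x == x′} e in ==⇒≡ x==x′ , ==⇒≡ y==y′

∖-intro : ∀ {n} (F : Fin n → Bool) {v x} → x ∈ F → x ≢ v → x ∈ F ∖ v
∖-intro F x∈F x≢v = ∧-true⁺ x∈F (not-true⁺ (≢⇒==false x≢v))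

∖-⊆ : ∀ {n} (F : Fin n → Bool) {v} → F ∖ v ⊆ F
∖-⊆ F {x = x} e = proj₁ (∧-true⁻ {F x} e)

∖-≢ : ∀ {n} (F : Fin n → Bool) {v x} → x ∈ F ∖ v → x ≢ v
∖-≢ F {x = x} e refl = true⇒≢false (==-refl x) (not-true⁻ (proj₂ (∧-true⁻ {F x} e)))

insert-∈ : ∀ {n} (v : Fin n) (C : Fin n → Bool) → v ∈ insert v C
insert-∈ v C = ∨-trueʳ {C v} (==-refl v)

contains⁻ : ∀ {n} {x y : Fin n} K → contains x y K ≡ true → x ∈ K × y ∈ K
contains⁻ {x = x} K = ∧-true⁻ {K x}

any-true⁺ : ∀ {A : Set} (f : A → Bool) {xs} → Any (λ x → f x ≡ true) xs → any f xs ≡ true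
any-true⁺ f = Equivalence.to T-≡ ∘ Anyₚ.any⁺ f ∘ Any.map (Equivalence.from T-≡)

any-true⁻ : ∀ {A : Set} (f : A → Bool) xs → any f xs ≡ true → Any (λ x → f x ≡ true) xs
any-true⁻ f xs = Any.map (Equivalence.to T-≡) ∘ Anyₚ.any⁻ f xs ∘ Equivalence.from T-≡

any-allFin⁺ : ∀ {n} {f : Fin n → Bool} i → f i ≡ true → any f (allFin n) ≡ true
any-allFin⁺ {f = f} i e = any-true⁺ f (Anyₚ.tabulate⁺ i e)

any-allFin⁻ : ∀ {n} {f : Fin n → Bool} → any f (allFin n) ≡ true → ∃[ i ] f i ≡ true
any-allFin⁻ {n} {f} e = Anyₚ.tabulate⁻ (any-true⁻ f (allFin n) e)

<ᵇ-true⁺ : ∀ {m n} → m < n → (m <ᵇ n) ≡ true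
<ᵇ-true⁺ = Equivalence.to T-≡ ∘ <⇒<ᵇ

<ᵇ-true⁻ : ∀ {m n} → (m <ᵇ n) ≡ true → m < n
<ᵇ-true⁻ {m} {n} = <ᵇ⇒< m n ∘ Equivalence.from T-≡

anyWithAll : ∀ {A : Set} {P Q R : A → Set} {xs} →
  (∀ {x} → P x → Q x → R x) → All P xs → Any Q xs → Any R xs
anyWithAll f (p ∷ _)  (here q)  = here (f p q)
anyWithAll f (_ ∷ ps) (there q) = there (anyWithAll f ps q)

Any⇒1≤length : ∀ {A : Set} {P : A → Set} {xs} → Any P xs → 1 ≤ length xs
Any⇒1≤length (here _)  = s≤s z≤n
Any⇒1≤length (there _) = s≤s z≤n

module _ {A : Set} {p : A → Bool} where

  filterᵇ-none : ∀ {xs} → All (λ x → p x ≡ false) xs → filterᵇ p xs ≡ []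
  filterᵇ-none = filter-none (T? ∘ p) ∘ All.map (λ px≡false → subst T px≡false)

  All-filterᵇ⁺ : ∀ {P : A → Set} {xs} → All (λ x → p x ≡ true → P x) xs → All P (filterᵇ p xs)
  All-filterᵇ⁺ {xs = []} [] = []
  All-filterᵇ⁺ {xs = x ∷ xs} (px⇒ ∷ pxs) with p x
  ... | true  = px⇒ refl ∷ All-filterᵇ⁺ pxs
  ... | false = All-filterᵇ⁺ pxs

  Any-filterᵇ⁺ : ∀ {P : A → Set} {xs} → Any (λ x → p x ≡ true × P x) xs → Any P (filterᵇ p xs)
  Any-filterᵇ⁺ {xs = x ∷ xs} (here (px , Px)) rewrite px = here Px
  Any-filterᵇ⁺ {xs = x ∷ xs} (there pxs) with p x
  ... | true  = there (Any-filterᵇ⁺ pxs)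
  ... | false = Any-filterᵇ⁺ pxs

  length-filterᵇ-≥1⁻ : ∀ {xs} → 1 ≤ length (filterᵇ p xs) → Any (λ x → p x ≡ true) xs
  length-filterᵇ-≥1⁻ {x ∷ xs} 1≤ with p x in px
  ... | true  = here px
  ... | false = there (length-filterᵇ-≥1⁻ 1≤)

  length-filterᵇ-≡0⁻ : ∀ {xs} → length (filterᵇ p xs) ≡ 0 → All (λ x → p x ≡ false) xs
  length-filterᵇ-≡0⁻ {[]} _ = []
  length-filterᵇ-≡0⁻ {x ∷ xs} ≡0 with p x in px
  ... | false = px ∷ length-filterᵇ-≡0⁻ ≡0

  length-filterᵇ-≤1 : ∀ {xs} → Unique xs →
    (∀ {x y} → x ∈ˡ xs → y ∈ˡ xs → p x ≡ true → p y ≡ true → x ≡ y) →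
    length (filterᵇ p xs) ≤ 1
  length-filterᵇ-≤1 {[]} [] p-unique = z≤n
  length-filterᵇ-≤1 {x ∷ xs} (x∉xs ∷ xs-unique) p-unique with p x in px
  ... | false = length-filterᵇ-≤1 xs-unique (λ x∈ y∈ → p-unique (there x∈) (there y∈))
  ... | true  = s≤s (≤-reflexive (cong length (filterᵇ-none
        (All.tabulate λ y∈xs → ¬-not (All.lookup x∉xs y∈xs ∘ p-unique (here refl) (there y∈xs) px)))))

  length-filterᵇ-≥1⁺ : ∀ {x xs} → x ∈ˡ xs → p x ≡ true → 1 ≤ length (filterᵇ p xs)
  length-filterᵇ-≥1⁺ x∈xs px =
    filter-some (T? ∘ p) (Any.map (λ { refl → Equivalence.from T-≡ px }) x∈xs)

module _ {A : Set} {p q : A → Bool} where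

  length-filterᵇ-mono : (∀ {x} → p x ≡ true → q x ≡ true) → ∀ xs →
    length (filterᵇ p xs) ≤ length (filterᵇ q xs)
  length-filterᵇ-mono p⇒q [] = z≤n
  length-filterᵇ-mono p⇒q (x ∷ xs) with p x in px | q x in qx
  ... | true  | true  = s≤s (length-filterᵇ-mono p⇒q xs)
  ... | true  | false = contradiction qx (true⇒≢false (p⇒q px))
  ... | false | true  = m≤n⇒m≤1+n (length-filterᵇ-mono p⇒q xs)
  ... | false | false = length-filterᵇ-mono p⇒q xs

  length-filterᵇ-mono-< : (∀ {x} → p x ≡ true → q x ≡ true) → ∀ {x xs} → x ∈ˡ xs →
    q x ≡ true → p x ≡ false → length (filterᵇ p xs) < length (filterᵇ q xs)
  length-filterᵇ-mono-< p⇒q {xs = _ ∷ xs} (here refl) qx px rewrite qx | px =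
    s≤s (length-filterᵇ-mono p⇒q xs)
  length-filterᵇ-mono-< p⇒q {xs = y ∷ xs} (there x∈xs) qx px with p y in py | q y in qy
  ... | true  | true  = s≤s (length-filterᵇ-mono-< p⇒q x∈xs qx px)
  ... | true  | false = contradiction qy (true⇒≢false (p⇒q py))
  ... | false | true  = m≤n⇒m≤1+n (length-filterᵇ-mono-< p⇒q x∈xs qx px)
  ... | false | false = length-filterᵇ-mono-< p⇒q x∈xs qx px

  length-filterᵇ-filterᵇ : ∀ xs → length (filterᵇ q (filterᵇ p xs)) ≤ length (filterᵇ q xs)
  length-filterᵇ-filterᵇ [] = z≤n
  length-filterᵇ-filterᵇ (x ∷ xs) with p x | q x in qx
  ... | true  | true  rewrite qx = s≤s (length-filterᵇ-filterᵇ xs)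
  ... | true  | false rewrite qx = length-filterᵇ-filterᵇ xs
  ... | false | true  = m≤n⇒m≤1+n (length-filterᵇ-filterᵇ xs)
  ... | false | false = length-filterᵇ-filterᵇ xs

length-filterᵇ-map : ∀ {A B : Set} (q : B → Bool) (f : A → B) xs →
  length (filterᵇ q (map f xs)) ≡ length (filterᵇ (q ∘ f) xs)
length-filterᵇ-map q f [] = refl
length-filterᵇ-map q f (x ∷ xs) with q (f x)
... | true  = cong suc (length-filterᵇ-map q f xs)
... | false = length-filterᵇ-map q f xs

filterᵇ-≢-witness : ∀ {n} {p : Fin n → Bool} {xs} → Unique xs → 2 ≤ length (filterᵇ p xs) →
  ∀ v → ∃[ x ] p x ≡ true × x ≢ v
filterᵇ-≢-witness {p = p} {y ∷ ys} (y∉ys ∷ ys-unique) 2≤ v with p y in py | y ≟ v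
... | true  | no y≢v  = y , py , y≢v
... | true  | yes refl =
  let pzs = length-filterᵇ-≥1⁻ {p = p} {ys} (s≤s⁻¹ 2≤)
      y≢z , pz = All.lookupAny y∉ys pzs
  in Any.lookup pzs , pz , y≢z ∘ sym
... | false | _ = filterᵇ-≢-witness ys-unique 2≤ v

length-filterᵇ-≥2⁺ : ∀ {n} {p : Fin n → Bool} {x y xs} → x ∈ˡ xs → y ∈ˡ xs → x ≢ y →
  p x ≡ true → p y ≡ true → 2 ≤ length (filterᵇ p xs)
length-filterᵇ-≥2⁺ {p = p} {x} {y} x∈xs y∈xs x≢y px py =
  ≤-trans (s≤s (length-filterᵇ-≥1⁺ {p = λ z → p z ∧ not (z == y)} x∈xs
                  (∧-true⁺ px (not-true⁺ (≢⇒==false x≢y)))))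
          (length-filterᵇ-mono-< (λ {z} e → proj₁ (∧-true⁻ {p z} e)) y∈xs py
             (subst (λ b → p y ∧ not b ≡ false) (sym (==-refl y)) (∧-zeroʳ (p y))))

size-≤ : ∀ {n} (S : Fin n → Bool) → size S ≤ n
size-≤ {n} S = ≤-trans (length-filter (T? ∘ S) (allFin n)) (≤-reflexive (length-tabulate (λ i → i)))

atLeastTwo⁺ : ∀ {n} {S : Fin n → Bool} {x y} → x ≢ y → x ∈ S → y ∈ S → atLeastTwo S ≡ true
atLeastTwo⁺ {x = x} {y} x≢y x∈S y∈S =
  <ᵇ-true⁺ (length-filterᵇ-≥2⁺ (∈-allFin x) (∈-allFin y) x≢y x∈S y∈S)

atLeastTwo⁻ : ∀ {n} {S : Fin n → Bool} → atLeastTwo S ≡ true → ∀ v → ∃[ x ] x ∈ S × x ≢ v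
atLeastTwo⁻ {n} two = filterᵇ-≢-witness (Uniqueₚ.allFin⁺ n) (<ᵇ-true⁻ two)

length-filterᵇ-concatMap-≤ : ∀ {A : Set} {q : A → Bool} (f : A → List A) {xs} →
  All (λ x → length (filterᵇ q (f x)) ≤ length (filterᵇ q [ x ])) xs →
  length (filterᵇ q (concatMap f xs)) ≤ length (filterᵇ q xs)
length-filterᵇ-concatMap-≤ f {[]} [] = z≤n
length-filterᵇ-concatMap-≤ {q = q} f {x ∷ xs} (fx≤ ∷ rest) = begin
  length (filterᵇ q (f x ++ concatMap f xs))
    ≡⟨ cong length (filter-++ (T? ∘ q) (f x) (concatMap f xs)) ⟩
  length (filterᵇ q (f x) ++ filterᵇ q (concatMap f xs))
    ≡⟨ length-++ (filterᵇ q (f x)) ⟩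
  length (filterᵇ q (f x)) + length (filterᵇ q (concatMap f xs))
    ≤⟨ +-mono-≤ fx≤ (length-filterᵇ-concatMap-≤ f rest) ⟩
  length (filterᵇ q [ x ]) + length (filterᵇ q xs)
    ≡⟨ length-++ (filterᵇ q [ x ]) ⟨
  length (filterᵇ q [ x ] ++ filterᵇ q xs)
    ≡⟨ cong length (filter-++ (T? ∘ q) [ x ] xs) ⟨
  length (filterᵇ q (x ∷ xs)) ∎
  where open ≤-Reasoning

module _ {A B : Set} (f : A → List B) where

  length-concatMap-≥ : ∀ {xs} → All (λ x → 1 ≤ length (f x)) xs → length xs ≤ length (concatMap f xs)
  length-concatMap-≥ [] = z≤n
  length-concatMap-≥ {x ∷ xs} (fx≥1 ∷ rest) =
    ≤-trans (+-mono-≤ fx≥1 (length-concatMap-≥ rest)) (≤-reflexive (sym (length-++ (f x))))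

  length-concatMap-> : ∀ {xs} → All (λ x → 1 ≤ length (f x)) xs → Any (λ x → 2 ≤ length (f x)) xs →
    length xs < length (concatMap f xs)
  length-concatMap-> {x ∷ xs} (_ ∷ rest) (here fx≥2) =
    ≤-trans (+-mono-≤ fx≥2 (length-concatMap-≥ rest)) (≤-reflexive (sym (length-++ (f x))))
  length-concatMap-> {x ∷ xs} (fx≥1 ∷ rest) (there more) =
    ≤-trans (+-mono-≤ fx≥1 (length-concatMap-> rest more)) (≤-reflexive (sym (length-++ (f x))))

  length-concatMap-≥-1 : (q : A → Bool) → ∀ {xs} →
    All (λ x → q x ≡ false → 1 ≤ length (f x)) xs → length (filterᵇ q xs) ≤ 1 →
    length xs ≤ suc (length (concatMap f xs))
  length-concatMap-≥-1 q [] _ = z≤n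
  length-concatMap-≥-1 q {x ∷ xs} (fx≥1 ∷ rest) ≤1 with q x
  ... | true  = s≤s (≤-trans (length-concatMap-≥ (All.zipWith (λ (h , qy) → h qy) (rest , rest-false)))
                     (≤-trans (m≤n+m _ (length (f x))) (≤-reflexive (sym (length-++ (f x))))))
    where
    rest-false : All (λ y → q y ≡ false) xs
    rest-false = length-filterᵇ-≡0⁻ (n≤0⇒n≡0 (s≤s⁻¹ ≤1))
  ... | false = ≤-trans (s≤s (length-concatMap-≥-1 q rest ≤1))
                  (s≤s (≤-trans (+-monoˡ-≤ _ (fx≥1 refl)) (≤-reflexive (sym (length-++ (f x))))))

-- Walks and connected components

Symmetric : ∀ {n} → Graph n → Set
Symmetric G = ∀ x y → G x y ≡ G y x

Loopless : ∀ {n} → Graph n → Set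
Loopless G = ∀ x → G x x ≡ false

data Walk {n} (G : Graph n) (S : Fin n → Bool) (u : Fin n) : Fin n → Set where
  stay   : u ∈ S → Walk G S u u
  extend : ∀ {w y} → Walk G S u w → y ∈ S → G w y ≡ true → Walk G S u y

module _ {n} {G : Graph n} {S : Fin n → Bool} where

  walk-source : ∀ {u y} → Walk G S u y → u ∈ S
  walk-source (stay u∈S)     = u∈S
  walk-source (extend p _ _) = walk-source p

  walk-target : ∀ {u y} → Walk G S u y → y ∈ S
  walk-target (stay u∈S)       = u∈S
  walk-target (extend _ y∈S _) = y∈S

  walk-trans : ∀ {u w y} → Walk G S u w → Walk G S w y → Walk G S u y
  walk-trans p (stay _)         = p
  walk-trans p (extend q y∈S g) = extend (walk-trans p q) y∈S g

  walk-edge : ∀ {x y} → x ∈ S → y ∈ S → G x y ≡ true → Walk G S x y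
  walk-edge x∈S y∈S g = extend (stay x∈S) y∈S g

  walk-sym : Symmetric G → ∀ {u y} → Walk G S u y → Walk G S y u
  walk-sym symG (stay u∈S) = stay u∈S
  walk-sym symG {y = y} (extend {w} p y∈S g) =
    walk-trans (walk-edge y∈S (walk-target p) (trans (symG y w) g)) (walk-sym symG p)

  walk-length : ∀ {u y} → Walk G S u y → ℕ
  walk-length (stay _)       = 0
  walk-length (extend p _ _) = suc (walk-length p)

walk-map : ∀ {n} {G G′ : Graph n} {S S′ : Fin n → Bool} → S ⊆ S′ →
  (∀ {x y} → x ∈ S → y ∈ S → G x y ≡ true → G′ x y ≡ true) →
  ∀ {u y} → Walk G S u y → Walk G′ S′ u y
walk-map S⊆S′ G⇒G′ (stay u∈S)       = stay (S⊆S′ u∈S)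
walk-map S⊆S′ G⇒G′ (extend p y∈S g) =
  extend (walk-map S⊆S′ G⇒G′ p) (S⊆S′ y∈S) (G⇒G′ (walk-target p) y∈S g)

walk-widen : ∀ {n} {G : Graph n} {S S′ : Fin n → Bool} → S ⊆ S′ →
  ∀ {u y} → Walk G S u y → Walk G S′ u y
walk-widen S⊆S′ = walk-map S⊆S′ (λ _ _ g → g)

module _ {n} {G : Graph n} {S : Fin n → Bool} where

  reachWithin-suc : ∀ k {u y} → reachWithin G S k u y ≡ true → reachWithin G S (suc k) u y ≡ true
  reachWithin-suc k = ∨-trueˡ

  reachWithin⇒Walk : ∀ k {u y} → reachWithin G S k u y ≡ true → Walk G S u y
  reachWithin⇒Walk zero {u} e with ∧-true⁻ {S u} e
  ... | u∈S , u==y with ==⇒≡ u==y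
  ... | refl = stay u∈S
  reachWithin⇒Walk (suc k) {u} {y} e with ∨-true⁻ {reachWithin G S k u y} e
  ... | inj₁ e′ = reachWithin⇒Walk k e′
  ... | inj₂ e′ with any-allFin⁻ e′
  ... | w , e″ with ∧-true⁻ {reachWithin G S k u w} e″
  ... | u⇝w , y∈S∧g with ∧-true⁻ {S y} y∈S∧g
  ... | y∈S , g = extend (reachWithin⇒Walk k u⇝w) y∈S g

  Walk⇒reachWithin : ∀ {u y} (p : Walk G S u y) → reachWithin G S (walk-length p) u y ≡ true
  Walk⇒reachWithin {u} (stay u∈S) = ∧-true⁺ u∈S (==-refl u)
  Walk⇒reachWithin {u} {y} (extend {w} p y∈S g) = ∨-trueʳ {reachWithin G S (walk-length p) u y}
    (any-allFin⁺ w (∧-true⁺ (Walk⇒reachWithin p) (∧-true⁺ y∈S g)))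

  reachWithin-mono : ∀ {k m} → k ≤ m →
    ∀ {u y} → reachWithin G S k u y ≡ true → reachWithin G S m u y ≡ true
  reachWithin-mono {m = zero}  z≤n e = e
  reachWithin-mono {m = suc m} z≤n e = reachWithin-suc m (reachWithin-mono {m = m} z≤n e)
  reachWithin-mono {suc k} {suc m} (s≤s k≤m) {u} {y} e with ∨-true⁻ {reachWithin G S k u y} e
  ... | inj₁ e′ = ∨-trueˡ (reachWithin-mono k≤m e′)
  ... | inj₂ e′ with any-allFin⁻ e′
  ... | w , e″ with ∧-true⁻ {reachWithin G S k u w} e″
  ... | u⇝w , rest =
    ∨-trueʳ {reachWithin G S m u y} (any-allFin⁺ w (∧-true⁺ (reachWithin-mono k≤m u⇝w) rest))

  -- reachWithin (suc k) u is determined by reachWithin k u, so once a step adds no vertex no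
  -- later step does; as every productive step adds a vertex, all of them occur before step n.
  module Saturation (u : Fin n) where

    R : ℕ → Fin n → Bool
    R k = reachWithin G S k u

    Stable : ℕ → Set
    Stable k = ∀ y → R (suc k) y ≡ R k y

    stable-suc : ∀ k → Stable k → Stable (suc k)
    stable-suc k st y =
      cong₂ _∨_ (st y) (cong or (map-cong (λ w → cong (λ b → b ∧ S y ∧ G w y) (st w)) (allFin n)))

    stable-from : ∀ k → Stable k → ∀ j → Stable (j + k)
    stable-from k st zero    = st
    stable-from k st (suc j) = stable-suc (j + k) (stable-from k st j)

    stable-+ : ∀ k → Stable k → ∀ j y → R (j + k) y ≡ R k y
    stable-+ k st zero    y = refl
    stable-+ k st (suc j) y = trans (stable-from k st j y) (stable-+ k st j y)

    unstable-grows : ∀ k → ¬ Stable k → size (R k) < size (R (suc k))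
    unstable-grows k ¬st with ¬∀⟶∃¬ n _ (λ y → R (suc k) y ≟ᵇ R k y) ¬st
    ... | y , R′y≢Ry with new-vertex (reachWithin-suc k) R′y≢Ry
      where
      new-vertex : ∀ {a b : Bool} → (a ≡ true → b ≡ true) → b ≢ a → b ≡ true × a ≡ false
      new-vertex {true}  a⇒b b≢a = contradiction (a⇒b refl) b≢a
      new-vertex {false} a⇒b b≢a = ¬-not b≢a , refl
    ... | R′y , Ry = length-filterᵇ-mono-< (reachWithin-suc k) (∈-allFin y) R′y Ry

    size-grows : ∀ k → Stable k ⊎ suc k ≤ size (R (suc k))
    size-grows k with all? (λ y → R (suc k) y ≟ᵇ R k y)
    size-grows k       | yes st  = inj₁ st
    size-grows zero    | no  ¬st = inj₂ (≤-trans (s≤s z≤n) (unstable-grows zero ¬st))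
    size-grows (suc k) | no  ¬st with size-grows k
    ... | inj₁ st  = contradiction (stable-suc k st) ¬st
    ... | inj₂ k<  = inj₂ (≤-trans (s≤s k<) (unstable-grows (suc k) ¬st))

    stable-at-n : Stable n
    stable-at-n with size-grows n
    ... | inj₁ st = st
    ... | inj₂ n< = contradiction (size-≤ (R (suc n))) (<⇒≱ n<)

    saturated : ∀ k {y} → R k y ≡ true → R n y ≡ true
    saturated k {y} e with ≤-total k n
    ... | inj₁ k≤n = reachWithin-mono k≤n e
    ... | inj₂ n≤k = trans (sym (stable-+ n stable-at-n (k ∸ n) y))
                           (subst (λ m → R m y ≡ true) (sym (m∸n+n≡m n≤k)) e)

  Walk⇒reach : ∀ {u y} → Walk G S u y → reach G S u y ≡ true
  Walk⇒reach {u} p = Saturation.saturated u (walk-length p) (Walk⇒reachWithin p)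

  reach⇒Walk : ∀ {u y} → reach G S u y ≡ true → Walk G S u y
  reach⇒Walk = reachWithin⇒Walk n

Walk? : ∀ {n} (G : Graph n) S u y → Dec (Walk G S u y)
Walk? G S u y with reach G S u y in e
... | true  = yes (reach⇒Walk e)
... | false = no (λ u⇝y → true⇒≢false (Walk⇒reach u⇝y) e)

Connected : ∀ {n} → Graph n → (Fin n → Bool) → Set
Connected G F = ∀ {x y} → x ∈ F → y ∈ F → Walk G F x y

module Components {n} (G : Graph n) (S : Fin n → Bool) where

  isRoot : Fin n → Bool
  isRoot r = S r ∧ not (any (λ u → (toℕ u <ᵇ toℕ r) ∧ reach G S u r) (allFin n))

  roots : List (Fin n)
  roots = filterᵇ isRoot (allFin n)

  component : Fin n → Fin n → Bool
  component r = reach G S r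

  isRoot⁺ : ∀ {r} → r ∈ S → (∀ {u} → toℕ u < toℕ r → ¬ Walk G S u r) → isRoot r ≡ true
  isRoot⁺ {r} r∈S minimal with any (λ u → (toℕ u <ᵇ toℕ r) ∧ reach G S u r) (allFin n) in e
  ... | false = ∧-true⁺ r∈S refl
  ... | true with any-allFin⁻ e
  ... | u , e′ with ∧-true⁻ {toℕ u <ᵇ toℕ r} e′
  ... | u<r , u⇝r = contradiction (reach⇒Walk u⇝r) (minimal (<ᵇ-true⁻ u<r))

  isRoot-∈ : ∀ {r} → isRoot r ≡ true → r ∈ S
  isRoot-∈ {r} e = proj₁ (∧-true⁻ {S r} e)

  isRoot-minimal : ∀ {r u} → isRoot r ≡ true → toℕ u < toℕ r → ¬ Walk G S u r
  isRoot-minimal {r} {u} e u<r u⇝r =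
    true⇒≢false (any-allFin⁺ u (∧-true⁺ (<ᵇ-true⁺ u<r) (Walk⇒reach u⇝r)))
                (not-true⁻ (proj₂ (∧-true⁻ {S r} e)))

  root-exists : ∀ {x} → x ∈ S → ∃[ r ] isRoot r ≡ true × Walk G S r x
  root-exists {x} x∈S = descend (<-wellFounded x) (stay x∈S)
    where
    descend : ∀ {y} → Acc Fin._<_ y → Walk G S y x → ∃[ r ] isRoot r ≡ true × Walk G S r x
    descend {y} (acc smaller) y⇝x with any (λ u → (toℕ u <ᵇ toℕ y) ∧ reach G S u y) (allFin n) in e
    ... | false = y , ∧-true⁺ (walk-source y⇝x) (not-true⁺ e) , y⇝x
    ... | true with any-allFin⁻ e
    ... | u , e′ with ∧-true⁻ {toℕ u <ᵇ toℕ y} e′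
    ... | u<y , u⇝y = descend (smaller (<ᵇ-true⁻ u<y)) (walk-trans (reach⇒Walk u⇝y) y⇝x)

  root-unique : Symmetric G → ∀ {r r′ x} → isRoot r ≡ true → isRoot r′ ≡ true →
    Walk G S r x → Walk G S r′ x → r ≡ r′
  root-unique symG {r} {r′} rr rr′ r⇝x r′⇝x with <-cmp (toℕ r) (toℕ r′)
  ... | tri< r<r′ _ _ = contradiction (walk-trans r⇝x (walk-sym symG r′⇝x)) (isRoot-minimal rr′ r<r′)
  ... | tri≈ _ r≡r′ _ = toℕ-injective r≡r′
  ... | tri> _ _ r′<r = contradiction (walk-trans r′⇝x (walk-sym symG r⇝x)) (isRoot-minimal rr r′<r)

  ∈component⇒Walk : ∀ {r x} → x ∈ component r → Walk G S r x
  ∈component⇒Walk = reach⇒Walk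

  Walk⇒∈component : ∀ {r x} → Walk G S r x → x ∈ component r
  Walk⇒∈component = Walk⇒reach

  component-⊆ : ∀ {r} → component r ⊆ S
  component-⊆ = walk-target ∘ ∈component⇒Walk

  component-closed : ∀ {r x y} → x ∈ component r → y ∈ S → G x y ≡ true → y ∈ component r
  component-closed r⇝x y∈S g = Walk⇒∈component (extend (∈component⇒Walk r⇝x) y∈S g)

  walk-in-component : ∀ {r x} → Walk G S r x → Walk G (component r) r x
  walk-in-component (stay r∈S)           = stay (Walk⇒∈component (stay r∈S))
  walk-in-component p@(extend p′ y∈S g) = extend (walk-in-component p′) (Walk⇒∈component p) g

  component-connected : Symmetric G → ∀ r → Connected G (component r)
  component-connected symG r x∈ y∈ =
    walk-trans (walk-sym symG (walk-in-component (∈component⇒Walk x∈)))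
               (walk-in-component (∈component⇒Walk y∈))

  components-length : length (components G S) ≡ length roots
  components-length = length-map component roots

  components-All : ∀ {P : (Fin n → Bool) → Set} → (∀ {r} → isRoot r ≡ true → P (component r)) →
    All P (components G S)
  components-All h = Allₚ.map⁺ (All-filterᵇ⁺ {p = isRoot} (Allₚ.tabulate⁺ {f = λ r → r} λ _ → h))

  components-Any : ∀ {P : (Fin n → Bool) → Set} {r} → isRoot r ≡ true → P (component r) →
    Any P (components G S)
  components-Any {r = r} rr Pr = Anyₚ.map⁺ (Any-filterᵇ⁺ (Anyₚ.tabulate⁺ r (rr , Pr)))

  components-≥1 : ∀ {x} → x ∈ S → 1 ≤ length (components G S)
  components-≥1 x∈S with root-exists x∈S
  ... | r , rr , _ = subst (1 ≤_) (sym components-length) (length-filterᵇ-≥1⁺ (∈-allFin r) rr)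

  components-≥2 : Symmetric G → ∀ {x y} → x ∈ S → y ∈ S → ¬ Walk G S x y →
    2 ≤ length (components G S)
  components-≥2 symG x∈S y∈S x≁y with root-exists x∈S | root-exists y∈S
  ... | r , rr , r⇝x | r′ , rr′ , r′⇝y =
    subst (2 ≤_) (sym components-length)
      (length-filterᵇ-≥2⁺ (∈-allFin r) (∈-allFin r′) r≢r′ rr rr′)
    where
    r≢r′ : r ≢ r′
    r≢r′ refl = x≁y (walk-trans (walk-sym symG r⇝x) r′⇝y)

  components-≤1 : Symmetric G → (q : (Fin n → Bool) → Bool) (z : Fin n) →
    (∀ {r} → q (component r) ≡ true → Walk G S r z) → length (filterᵇ q (components G S)) ≤ 1
  components-≤1 symG q z reaches-z = subst (_≤ 1) (sym (length-filterᵇ-map q component roots))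
    (length-filterᵇ-≤1 (Uniqueₚ.filter⁺ (T? ∘ isRoot) (Uniqueₚ.allFin⁺ n))
      λ r∈ r′∈ qr qr′ → root-unique symG (is-root r∈) (is-root r′∈) (reaches-z qr) (reaches-z qr′))
    where
    is-root : ∀ {r} → r ∈ˡ roots → isRoot r ≡ true
    is-root r∈ = Equivalence.to T-≡ (proj₂ (∈-filter⁻ (T? ∘ isRoot) {xs = allFin n} r∈))

componentCount : ∀ {n} → Graph n → ℕ
componentCount G = length (components G allV)

module _ {n} {G G′ : Graph n} (G′⇒G : ∀ {u y} → Walk G′ allV u y → Walk G allV u y) where
  open Components

  roots-mono : ∀ {r} → isRoot G allV r ≡ true → isRoot G′ allV r ≡ true
  roots-mono rr = isRoot⁺ G′ allV refl (λ u<r u⇝r → isRoot-minimal G allV rr u<r (G′⇒G u⇝r))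

  componentCount-mono : componentCount G ≤ componentCount G′
  componentCount-mono = subst₂ _≤_ (sym (components-length G allV)) (sym (components-length G′ allV))
    (length-filterᵇ-mono roots-mono (allFin n))

  componentCount-mono-< : Symmetric G → Symmetric G′ →
    ∀ {x y} → Walk G allV x y → ¬ Walk G′ allV x y → componentCount G < componentCount G′
  componentCount-mono-< symG symG′ {x} {y} x⇝y x≁y
    with root-exists G′ allV {x} refl | root-exists G′ allV {y} refl
  ... | r , rr , r⇝x | r′ , rr′ , r′⇝y =
    subst₂ _<_ (sym (components-length G allV)) (sym (components-length G′ allV))
      (fewer-roots (<-cmp (toℕ r) (toℕ r′)))
    where
    r⇝r′ : Walk G allV r r′
    r⇝r′ = walk-trans (G′⇒G r⇝x) (walk-trans x⇝y (walk-sym symG (G′⇒G r′⇝y)))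
    r≢r′ : r ≢ r′
    r≢r′ refl = x≁y (walk-trans (walk-sym symG′ r⇝x) r′⇝y)
    -- r and r′ are joined in G, so the larger of them is no root of G
    fewer-roots : Tri (toℕ r < toℕ r′) (toℕ r ≡ toℕ r′) (toℕ r′ < toℕ r) →
      length (filterᵇ (isRoot G allV) (allFin n)) < length (filterᵇ (isRoot G′ allV) (allFin n))
    fewer-roots (tri< r<r′ _ _) = length-filterᵇ-mono-< roots-mono (∈-allFin r′) rr′
      (¬-not (λ rr′G → isRoot-minimal G allV rr′G r<r′ r⇝r′))
    fewer-roots (tri≈ _ r≡r′ _) = contradiction (toℕ-injective r≡r′) r≢r′
    fewer-roots (tri> _ _ r′<r) = length-filterᵇ-mono-< roots-mono (∈-allFin r) rr
      (¬-not (λ rrG → isRoot-minimal G allV rrG r′<r (walk-sym symG r⇝r′)))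

componentCount-cong : ∀ {n} {G G′ : Graph n} → (∀ {u y} → Walk G allV u y → Walk G′ allV u y) →
  (∀ {u y} → Walk G′ allV u y → Walk G allV u y) → componentCount G ≡ componentCount G′
componentCount-cong G⇒G′ G′⇒G =
  ≤-antisym (componentCount-mono G′⇒G) (componentCount-mono G⇒G′)

-- Closed vertex sets

outside : ∀ {n} → (Fin n → Bool) → Fin n → Fin n → Bool
outside F u x = not (F x) ∨ (x == u)

Closed : ∀ {n} → Graph n → (Fin n → Bool) → Set
Closed G F = ∀ {u y w} → u ∈ F → y ∈ F → u ≢ y → w ∉ F → G w y ≡ true →
  ¬ Walk G (outside F u) u w

closed-mono : ∀ {n} {G G′ : Graph n} {F} → (∀ {x y} → G′ x y ≡ true → G x y ≡ true) →
  Closed G F → Closed G′ F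
closed-mono G′⇒G closed u∈F y∈F u≢y w∉F g u⇝w =
  closed u∈F y∈F u≢y w∉F (G′⇒G g) (walk-map (λ e → e) (λ _ _ → G′⇒G) u⇝w)

module _ {n} {G : Graph n} {F S : Fin n → Bool} (closed : Closed G F)
         (U : Fin n → Set) (U⊆F : ∀ {p} → U p → p ∈ F)
         (U-step : ∀ {p q} → U p → q ∈ F → q ∈ S → G p q ≡ true → U q) where

  -- By closedness a walk that leaves F re-enters F only where it left, so it either stays in U
  -- or ends with an excursion out of F from a vertex of U.
  escape : ∀ {z p} → U z → Walk G S z p → U p ⊎ (p ∉ F × ∃[ u ] U u × Walk G (outside F u) u p)
  escape Uz (stay _) = inj₁ Uz
  escape Uz (extend {w} {q} z⇝w q∈S g) with escape Uz z⇝w | F q in Fq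
  ... | inj₁ Uw | true  = inj₁ (U-step Uw Fq q∈S g)
  ... | inj₁ Uw | false =
    inj₂ (refl , w , Uw , walk-edge (∨-trueʳ {not (F w)} (==-refl w)) (∨-trueˡ (not-true⁺ Fq)) g)
  ... | inj₂ (w∉F , u , Uu , u⇝w) | true with u ≟ q
  ...   | yes refl = inj₁ Uu
  ...   | no  u≢q  = contradiction u⇝w (closed (U⊆F Uu) Fq u≢q w∉F g)
  escape Uz (extend {w} {q} z⇝w q∈S g) | inj₂ (w∉F , u , Uu , u⇝w) | false =
    inj₂ (refl , u , Uu , extend u⇝w (∨-trueˡ (not-true⁺ Fq)) g)

confine : ∀ {n} {G : Graph n} {F S : Fin n → Bool} → Closed G F → ∀ {x y} → x ∈ F → y ∈ F →
  Walk G S x y → Walk G F x y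
confine {G = G} {F} closed {x} x∈F y∈F x⇝y
  with escape closed (Walk G F x) walk-target (λ p q∈F _ g → extend p q∈F g) (stay x∈F) x⇝y
... | inj₁ x⇝y′      = x⇝y′
... | inj₂ (y∉F , _) = contradiction y∉F (true⇒≢false y∈F)

-- A walk leaving K at z can step into F ∖ K only if z = c, and it stays in F ∖ K (U below)
-- until it leaves F, where the closedness of F forbids it to come back to K.
closed-⊆ : ∀ {n} {G : Graph n} {F K : Fin n → Bool} → Symmetric G → Closed G F → K ⊆ F →
  (c : Fin n) → (∀ {x y} → x ∈ K → y ∈ F → y ∉ K → G x y ≡ true → x ≡ c) → Closed G K
closed-⊆ {n} {G} {F} {K} symG closedF K⊆F c exits-at-c {z} {y} {w} z∈K y∈K z≢y w∉K g z⇝w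
  with escape closedF U U⊆F U-step (inj₁ refl) z⇝w
  where
  U : Fin n → Set
  U p = p ≡ z ⊎ (z ≡ c × p ∈ F × p ∉ K)
  U⊆F : ∀ {p} → U p → p ∈ F
  U⊆F (inj₁ refl)          = K⊆F z∈K
  U⊆F (inj₂ (_ , p∈F , _)) = p∈F
  U-step : ∀ {p q} → U p → q ∈ F → q ∈ outside K z → G p q ≡ true → U q
  U-step {q = q} Up q∈F q-out g with ∨-true⁻ {not (K q)} q-out
  ... | inj₂ q==z = inj₁ (==⇒≡ q==z)
  ... | inj₁ q∉K with Up
  ...   | inj₁ refl          = inj₂ (exits-at-c z∈K q∈F (not-true⁻ q∉K) g , q∈F , not-true⁻ q∉K)
  ...   | inj₂ (z≡c , _ , _) = inj₂ (z≡c , q∈F , not-true⁻ q∉K)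
... | inj₁ (inj₁ refl) = true⇒≢false z∈K w∉K
... | inj₁ (inj₂ (z≡c , w∈F , _)) =
  z≢y (trans z≡c (sym (exits-at-c y∈K w∈F w∉K (trans (symG y w) g))))
... | inj₂ (w∉F , _ , inj₁ refl , z⇝w′) = closedF (K⊆F z∈K) (K⊆F y∈K) z≢y w∉F g z⇝w′
... | inj₂ (w∉F , u , inj₂ (_ , u∈F , u∉K) , u⇝w) =
  closedF u∈F (K⊆F y∈K) (λ { refl → true⇒≢false y∈K u∉K }) w∉F g u⇝w

-- The invariant and its preservation

record WellFormed {n} (G : Graph n) (F : Fin n → Bool) : Set where
  field
    nontrivial : atLeastTwo F ≡ true
    connected  : Connected G F
    closed     : Closed G F

record Tracks {n} (G : Graph n) (H : Hypergraph n) : Set where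
  field
    symmetric  : Symmetric G
    loopless   : Loopless G
    wellFormed : All (WellFormed G) H
    covers     : ∀ {x y} → G x y ≡ true → Any (λ F → x ∈ F × y ∈ F) H
    linear     : ∀ {x y} → x ≢ y → length (filterᵇ (contains x y) H) ≤ 1

record Splits {n} (G : Graph n) (F : Fin n → Bool) (L : Hypergraph n) : Set where
  field
    wellFormed : All (WellFormed G) L
    covers     : ∀ {x y} → x ∈ F → y ∈ F → x ≢ y → G x y ≡ true →
                 Any (λ K → x ∈ K × y ∈ K) L
    linear     : ∀ {x y} → x ≢ y →
                 length (filterᵇ (contains x y) L) ≤ length (filterᵇ (contains x y) [ F ])

tracks-concatMap : ∀ {n} {G G′ : Graph n} {H} → Tracks G H → Symmetric G′ →
  (∀ {x y} → G′ x y ≡ true → G x y ≡ true) →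
  (R : (Fin n → Bool) → Hypergraph n) → (∀ {F} → WellFormed G F → Splits G′ F (R F)) →
  Tracks G′ (concatMap R H)
tracks-concatMap {G′ = G′} tracks symG′ G′⇒G R split = record
  { symmetric  = symG′
  ; loopless   = λ x → ¬-not (λ gxx → true⇒≢false (G′⇒G gxx) (loopless x))
  ; wellFormed = Allₚ.concat⁺ (Allₚ.map⁺ (All.map (λ wf → Splits.wellFormed (split wf)) wellFormed))
  ; covers     = λ g → Anyₚ.concatMap⁺ R (anyWithAll
      (λ wf (x∈F , y∈F) → Splits.covers (split wf) x∈F y∈F (edge-≢ g) g) wellFormed (covers (G′⇒G g)))
  ; linear     = λ x≢y → ≤-trans
      (length-filterᵇ-concatMap-≤ R (All.map (λ wf → Splits.linear (split wf) x≢y) wellFormed))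
      (linear x≢y)
  }
  where
  open Tracks tracks
  edge-≢ : ∀ {x y} → G′ x y ≡ true → x ≢ y
  edge-≢ {x} g refl = true⇒≢false (G′⇒G g) (loopless x)

module _ {n} {G : Graph n} {a b : Fin n} where

  removeEdge-⊆ : ∀ {x y} → removeEdge G a b x y ≡ true → G x y ≡ true
  removeEdge-⊆ {x} {y} e = proj₁ (∧-true⁻ {G x y} e)

  removeEdge-sym : Symmetric G → Symmetric (removeEdge G a b)
  removeEdge-sym symG x y = cong₂ _∧_ (symG x y) (cong not (trans (∨-comm ((x == a) ∧ (y == b)) _)
    (cong₂ _∨_ (∧-comm (x == b) (y == a)) (∧-comm (x == a) (y == b)))))

  removeEdge-removed : ∀ {x y} → removeEdge G a b x y ≡ true →
    ¬ ((x ≡ a × y ≡ b) ⊎ (x ≡ b × y ≡ a))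
  removeEdge-removed {x} {y} e (inj₁ (refl , refl)) =
    true⇒≢false (∨-trueˡ (∧-true⁺ (==-refl x) (==-refl y)))
      (not-true⁻ (proj₂ (∧-true⁻ {G x y} e)))
  removeEdge-removed {x} {y} e (inj₂ (refl , refl)) =
    true⇒≢false (∨-trueʳ {(x == a) ∧ (y == b)} (∧-true⁺ (==-refl x) (==-refl y)))
      (not-true⁻ (proj₂ (∧-true⁻ {G x y} e)))

  removeEdge-keeps : ∀ {x y} → G x y ≡ true → ¬ ((x ≡ a × y ≡ b) ⊎ (x ≡ b × y ≡ a)) →
    removeEdge G a b x y ≡ true
  removeEdge-keeps {x} {y} g not-ab =
    ∧-true⁺ g (not-true⁺ (¬-not (not-ab ∘ Sum.map ==-both ==-both ∘ ∨-true⁻ {(x == a) ∧ (y == b)})))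

  wellFormed-removeEdge : ∀ {F} → WellFormed G F → contains a b F ≡ false →
    WellFormed (removeEdge G a b) F
  wellFormed-removeEdge {F} wf ab∉F = record
    { nontrivial = nontrivial
    ; connected  = λ x∈F y∈F → walk-map (λ e → e) keep (connected x∈F y∈F)
    ; closed     = closed-mono removeEdge-⊆ closed
    }
    where
    open WellFormed wf
    keep : ∀ {x y} → x ∈ F → y ∈ F → G x y ≡ true → removeEdge G a b x y ≡ true
    keep x∈F y∈F g = removeEdge-keeps g λ
      { (inj₁ (refl , refl)) → true⇒≢false (∧-true⁺ x∈F y∈F) ab∉F
      ; (inj₂ (refl , refl)) → true⇒≢false (∧-true⁺ y∈F x∈F) ab∉F }

pieces : ∀ {n} → Graph n → (Fin n → Bool) → Hypergraph n
pieces G F = filterᵇ atLeastTwo (components G F)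

vertexPieces : ∀ {n} → Graph n → Fin n → (Fin n → Bool) → Hypergraph n
vertexPieces G v F = map (insert v) (components G (F ∖ v))

edgeSplit : ∀ {n} → Graph n → Fin n → Fin n → (Fin n → Bool) → Hypergraph n
edgeSplit G a b F = if F a ∧ F b then pieces G F else [ F ]

vertexSplit : ∀ {n} → Graph n → Fin n → (Fin n → Bool) → Hypergraph n
vertexSplit G v F = if F v then vertexPieces G v F else [ F ]

splits-self : ∀ {n} {G : Graph n} {F} → WellFormed G F → Splits G F [ F ]
splits-self wf = record
  { wellFormed = wf ∷ []
  ; covers     = λ x∈F y∈F _ _ → here (x∈F , y∈F)
  ; linear     = λ _ → ≤-refl
  }

linear-⊆ : ∀ {n} {F : Fin n → Bool} {L : Hypergraph n} {x y} → All (λ K → K ⊆ F) L →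
  length (filterᵇ (contains x y) L) ≤ 1 →
  length (filterᵇ (contains x y) L) ≤ length (filterᵇ (contains x y) [ F ])
linear-⊆ {F = F} {x = x} {y} L⊆F ≤1 with F x ∧ F y in xy∈F
... | true  = ≤1
... | false = ≤-reflexive (cong length (filterᵇ-none (All.map outside-F L⊆F)))
  where
  outside-F : ∀ {K} → K ⊆ F → contains x y K ≡ false
  outside-F {K} K⊆F = ¬-not λ xy∈K →
    let x∈K , y∈K = contains⁻ K xy∈K in true⇒≢false (∧-true⁺ (K⊆F x∈K) (K⊆F y∈K)) xy∈F

module _ {n} {G : Graph n} {F : Fin n → Bool} (symG : Symmetric G) where
  open Components G F

  pieces-⊆ : All (λ K → K ⊆ F) (pieces G F)
  pieces-⊆ = Allₚ.filter⁺ (T? ∘ atLeastTwo) (components-All (λ _ → component-⊆))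

  pieces-joining : ∀ {x y} → x ≢ y → Walk G F x y → Any (λ K → x ∈ K × y ∈ K) (pieces G F)
  pieces-joining x≢y x⇝y with root-exists (walk-source x⇝y)
  ... | r , rr , r⇝x =
    let x∈C = Walk⇒∈component r⇝x
        y∈C = Walk⇒∈component (walk-trans r⇝x x⇝y)
    in Any-filterᵇ⁺ (components-Any rr (atLeastTwo⁺ x≢y x∈C y∈C , x∈C , y∈C))

  splits-pieces : Closed G F → Splits G F (pieces G F)
  splits-pieces closedF = record
    { wellFormed = All-filterᵇ⁺ (components-All λ {r} _ two → record
        { nontrivial = two
        ; connected  = component-connected symG r
        ; closed     = closed-⊆ symG closedF component-⊆ r
            λ x∈C y∈F y∉C g → contradiction y∉C (true⇒≢false (component-closed x∈C y∈F g))
        })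
    ; covers     = λ x∈F y∈F x≢y g → pieces-joining x≢y (walk-edge x∈F y∈F g)
    ; linear     = λ {x} _ → linear-⊆ pieces-⊆ (≤-trans (length-filterᵇ-filterᵇ (components G F))
        (components-≤1 symG _ x (λ {r} e → ∈component⇒Walk (proj₁ (contains⁻ (component r) e)))))
    }

module _ {n} {G : Graph n} {F : Fin n → Bool} {v : Fin n} (symG : Symmetric G) where
  open Components G (F ∖ v)

  insert-∈⁻ : ∀ C {z} → z ∈ insert v C → z ≢ v → z ∈ C
  insert-∈⁻ C {z} e z≢v with ∨-true⁻ {C z} e
  ... | inj₁ z∈C  = z∈C
  ... | inj₂ z==v = contradiction (==⇒≡ z==v) z≢v

  insert-⊆ : v ∈ F → ∀ {r} → insert v (component r) ⊆ F
  insert-⊆ v∈F {r} {x} e with ∨-true⁻ {component r x} e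
  ... | inj₁ x∈C  = ∖-⊆ F (component-⊆ x∈C)
  ... | inj₂ x==v with ==⇒≡ x==v
  ...   | refl = v∈F

  follow : ∀ {r x p} → x ∈ component r → Walk G F x p →
    (p ∈ component r × Walk G (insert v (component r)) x p) ⊎ Walk G (insert v (component r)) x v
  follow x∈C (stay _) = inj₁ (x∈C , stay (∨-trueˡ x∈C))
  follow {r} x∈C (extend {w} {q} x⇝w q∈F g) with follow x∈C x⇝w | q ≟ v
  ... | inj₂ x⇝v             | _        = inj₂ x⇝v
  ... | inj₁ (w∈C , x⇝w′) | yes refl = inj₂ (extend x⇝w′ (insert-∈ q (component r)) g)
  ... | inj₁ (w∈C , x⇝w′) | no q≢v   =
    let q∈C = component-closed w∈C (∖-intro F q∈F q≢v) g
    in inj₁ (q∈C , extend x⇝w′ (∨-trueˡ q∈C) g)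

  piece-to-v : Connected G F → v ∈ F → ∀ {r x} → x ∈ insert v (component r) →
    Walk G (insert v (component r)) x v
  piece-to-v conn v∈F {r} {x} x∈ with ∨-true⁻ {component r x} x∈
  ... | inj₂ x==v with ==⇒≡ x==v
  ...   | refl = stay (insert-∈ v (component r))
  piece-to-v conn v∈F {r} {x} x∈ | inj₁ x∈C
    with follow x∈C (conn (∖-⊆ F (component-⊆ x∈C)) v∈F)
  ... | inj₁ (v∈C , _) = contradiction refl (∖-≢ F (component-⊆ v∈C))
  ... | inj₂ x⇝v       = x⇝v

  vertexPieces-∋ : ∀ {z} {P : (Fin n → Bool) → Set} → z ∈ F ∖ v →
    (∀ {r} → z ∈ component r → P (insert v (component r))) → Any P (vertexPieces G v F)
  vertexPieces-∋ z∈ h with root-exists z∈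
  ... | r , rr , r⇝z = Anyₚ.map⁺ (components-Any rr (h (Walk⇒∈component r⇝z)))

  vertexPieces-≤1 : ∀ {x y} z → z ≢ v → (∀ K → contains x y K ≡ true → z ∈ K) →
    length (filterᵇ (contains x y) (vertexPieces G v F)) ≤ 1
  vertexPieces-≤1 {x} {y} z z≢v z∈ =
    subst (_≤ 1) (sym (length-filterᵇ-map (contains x y) (insert v) (components G (F ∖ v))))
      (components-≤1 symG _ z λ {r} e →
        ∈component⇒Walk (insert-∈⁻ (component r) (z∈ (insert v (component r)) e) z≢v))

  vertexPiece-wellFormed : WellFormed G F → v ∈ F → ∀ {r} → isRoot r ≡ true →
    WellFormed G (insert v (component r))
  vertexPiece-wellFormed wf v∈F {r} rr = record
    { nontrivial = atLeastTwo⁺ (∖-≢ F r∈) (∨-trueˡ (Walk⇒∈component (stay r∈)))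
                               (insert-∈ v (component r))
    ; connected  = λ x∈ y∈ →
        walk-trans (piece-to-v connected v∈F x∈) (walk-sym symG (piece-to-v connected v∈F y∈))
    ; closed     = closed-⊆ symG closed (insert-⊆ v∈F) v exits-at-v
    }
    where
    open WellFormed wf
    r∈ = isRoot-∈ rr
    exits-at-v : ∀ {x y} → x ∈ insert v (component r) → y ∈ F → y ∉ insert v (component r) →
      G x y ≡ true → x ≡ v
    exits-at-v {x} {y} x∈ y∈F y∉ g with ∨-false⁻ {component r y} y∉ | ∨-true⁻ {component r x} x∈
    ... | _ , y≠v   | inj₂ x==v = ==⇒≡ x==v
    ... | y∉C , y≠v | inj₁ x∈C  =
      contradiction y∉C (true⇒≢false (component-closed x∈C (∧-true⁺ y∈F (not-true⁺ y≠v)) g))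

  vertexPieces-cover : ∀ {x y} → x ∈ F → y ∈ F → x ≢ y → G x y ≡ true →
    Any (λ K → x ∈ K × y ∈ K) (vertexPieces G v F)
  vertexPieces-cover {x} {y} x∈F y∈F x≢y g with x ≟ v | y ≟ v
  ... | yes refl | yes refl = contradiction refl x≢y
  ... | yes refl | no y≢v   =
    vertexPieces-∋ (∖-intro F y∈F y≢v) (λ {r} y∈C → insert-∈ v (component r) , ∨-trueˡ y∈C)
  ... | no x≢v   | yes refl =
    vertexPieces-∋ (∖-intro F x∈F x≢v) (λ {r} x∈C → ∨-trueˡ x∈C , insert-∈ v (component r))
  ... | no x≢v   | no y≢v   = vertexPieces-∋ (∖-intro F x∈F x≢v)
    (λ x∈C → ∨-trueˡ x∈C , ∨-trueˡ (component-closed x∈C (∖-intro F y∈F y≢v) g))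

  vertexPieces-linear : ∀ {x y} → x ≢ y → length (filterᵇ (contains x y) (vertexPieces G v F)) ≤ 1
  vertexPieces-linear {x} {y} x≢y with x ≟ v
  ... | no x≢v   = vertexPieces-≤1 x x≢v (λ K e → proj₁ (contains⁻ K e))
  ... | yes refl = vertexPieces-≤1 y (x≢y ∘ sym) (λ K e → proj₂ (contains⁻ K e))

  splits-vertex : WellFormed G F → v ∈ F → Splits G F (vertexPieces G v F)
  splits-vertex wf v∈F = record
    { wellFormed = Allₚ.map⁺ (components-All (vertexPiece-wellFormed wf v∈F))
    ; covers     = vertexPieces-cover
    ; linear     = λ x≢y →
        linear-⊆ (Allₚ.map⁺ (components-All (λ _ → insert-⊆ v∈F))) (vertexPieces-linear x≢y)
    }

  vertexPieces-≥1 : ∀ {x} → x ∈ F → x ≢ v → 1 ≤ length (vertexPieces G v F)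
  vertexPieces-≥1 x∈F x≢v = subst (1 ≤_) (sym (length-map (insert v) (components G (F ∖ v))))
    (components-≥1 (∖-intro F x∈F x≢v))

  vertexPieces-≥2 : ∀ {x y} → x ∈ F ∖ v → y ∈ F ∖ v → ¬ Walk G (F ∖ v) x y →
    2 ≤ length (vertexPieces G v F)
  vertexPieces-≥2 x∈ y∈ x≁y = subst (2 ≤_) (sym (length-map (insert v) (components G (F ∖ v))))
    (components-≥2 symG x∈ y∈ x≁y)

module _ {n} {G : Graph n} (symG : Symmetric G) where

  edgeSplit-splits : ∀ {a b F} → WellFormed G F →
    Splits (removeEdge G a b) F (edgeSplit (removeEdge G a b) a b F)
  edgeSplit-splits {a} {b} {F} wf with F a ∧ F b in ab∈F
  ... | true  = splits-pieces (removeEdge-sym symG)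
                  (closed-mono (removeEdge-⊆ {G = G} {a} {b}) (WellFormed.closed wf))
  ... | false = splits-self (wellFormed-removeEdge wf ab∈F)

  vertexSplit-splits : ∀ {v F} → WellFormed G F → Splits G F (vertexSplit G v F)
  vertexSplit-splits {v} {F} wf with F v in v∈F
  ... | true  = splits-vertex symG wf v∈F
  ... | false = splits-self wf

module _ {n} {G : Graph n} {H : Hypergraph n} (tracks : Tracks G H) where
  open Tracks tracks

  tracks-edgeOp : ∀ a b → Tracks (removeEdge G a b) (edgeOp (removeEdge G a b) a b H)
  tracks-edgeOp a b =
    tracks-concatMap tracks (removeEdge-sym symmetric) (removeEdge-⊆ {G = G} {a} {b}) _
      (edgeSplit-splits symmetric)

  tracks-vertexOp : ∀ v → Tracks G (vertexOp G v H)
  tracks-vertexOp v = tracks-concatMap tracks symmetric (λ g → g) _ (vertexSplit-splits symmetric)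

  numComponents≡componentCount : numComponents H ≡ componentCount G
  numComponents≡componentCount = sym (componentCount-cong to-incidence from-incidence)
    where
    to-incidence : ∀ {u y} → Walk G allV u y → Walk (λ x y → any (contains x y) H) allV u y
    to-incidence = walk-map (λ e → e) λ {x} {y} _ _ g →
      any-true⁺ (contains x y) (Any.map (λ (x∈F , y∈F) → ∧-true⁺ x∈F y∈F) (covers g))
    from-incidence : ∀ {u y} → Walk (λ x y → any (contains x y) H) allV u y → Walk G allV u y
    from-incidence (stay _) = stay refl
    from-incidence (extend {w} {y} u⇝w _ g) = walk-trans (from-incidence u⇝w)
      (walk-widen (λ _ → refl) (proj₂ (Any.satisfied (anyWithAll {R = λ F → Walk G F w y}
        (λ {F} wf e → let w∈F , y∈F = contains⁻ F e in WellFormed.connected wf w∈F y∈F)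
        wellFormed (any-true⁻ (contains w y) H g)))))

tracks-hyperStep : ∀ {n} {G : Graph n} {H} → Tracks G H →
  ∀ st → Tracks (afterStep G st) (hyperStep G st H)
tracks-hyperStep tracks st = tracks-vertexOp (tracks-edgeOp tracks (a st) (b st)) (v st)

tracks-hyperAfter : ∀ {n} {G : Graph n} {H} → Tracks G H →
  ∀ sts → Tracks (afterSteps G sts) (hyperAfter G H sts)
tracks-hyperAfter tracks []         = tracks
tracks-hyperAfter tracks (st ∷ sts) = tracks-hyperAfter (tracks-hyperStep tracks st) sts

tracks-H₀ : ∀ {n} {G : Graph n} → Simple G → Tracks G (H₀ G)
tracks-H₀ {G = G} (symG , looplessG) = record
  { symmetric  = symG
  ; loopless   = looplessG
  ; wellFormed = Splits.wellFormed S
  ; covers     = λ {x} g → Splits.covers S refl refl (λ { refl → true⇒≢false g (looplessG x) }) g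
  ; linear     = Splits.linear S
  }
  where
  closed-allV : Closed G allV
  closed-allV _ _ _ ()
  S : Splits G allV (H₀ G)
  S = splits-pieces symG closed-allV

Separates : ∀ {n} → Graph n → Fin n → Fin n → Fin n → Set
Separates G v a b = a ≢ v × b ≢ v × (∀ {S} → Walk G S a b → v ∈ S)

separates-≢ : ∀ {n} {G : Graph n} {v a b} → Separates G v a b → a ≢ b
separates-≢ {v = v} (a≢v , _ , through) refl =
  ∖-≢ allV (through {S = allV ∖ v} (stay (∖-intro allV refl a≢v))) refl

module _ {n} {G : Graph n} {v : Fin n} (symG : Symmetric G) where

  vertexSplit-≥1 : ∀ {F} → WellFormed G F → 1 ≤ length (vertexSplit G v F)
  vertexSplit-≥1 {F} wf with F v
  ... | false = s≤s z≤n
  ... | true  = let x , x∈F , x≢v = atLeastTwo⁻ (WellFormed.nontrivial wf) v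
                in vertexPieces-≥1 symG x∈F x≢v

  vertexSplit-≥2 : ∀ {a b K} → Separates G v a b → WellFormed G K → a ∈ K → b ∈ K →
    2 ≤ length (vertexSplit G v K)
  vertexSplit-≥2 {a} {b} {K} (a≢v , b≢v , through) wf a∈K b∈K
    rewrite through (WellFormed.connected wf a∈K b∈K) =
      vertexPieces-≥2 symG (∖-intro K a∈K a≢v) (∖-intro K b∈K b≢v)
        (λ a⇝b → ∖-≢ K (through a⇝b) refl)

module _ {n} {G : Graph n} {H : Hypergraph n} {a b : Fin n} (tracks : Tracks G H) (a≢b : a ≢ b) where
  open Tracks tracks
  private
    G′ = removeEdge G a b

  edgeOp-length-≥-1 : length H ≤ suc (length (edgeOp G′ a b H))
  edgeOp-length-≥-1 =
    length-concatMap-≥-1 (edgeSplit G′ a b) (contains a b) (All.universal kept H) (linear a≢b)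
    where
    kept : ∀ F → contains a b F ≡ false → 1 ≤ length (edgeSplit G′ a b F)
    kept F ab∉F with F a ∧ F b
    ... | false = s≤s z≤n
    ... | true  = contradiction ab∉F λ ()

  pieces-removeEdge-joining : ∀ {F} → WellFormed G F → a ∈ F → b ∈ F → Walk G′ allV a b →
    Any (λ K → a ∈ K × b ∈ K) (pieces G′ F)
  pieces-removeEdge-joining wf a∈F b∈F a⇝b = pieces-joining (removeEdge-sym symmetric) a≢b
    (confine (closed-mono (removeEdge-⊆ {G = G} {a} {b}) (WellFormed.closed wf)) a∈F b∈F a⇝b)

  edgeOp-length-≥ : Walk G′ allV a b → length H ≤ length (edgeOp G′ a b H)
  edgeOp-length-≥ a⇝b = length-concatMap-≥ (edgeSplit G′ a b) (All.map kept wellFormed)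
    where
    kept : ∀ {F} → WellFormed G F → 1 ≤ length (edgeSplit G′ a b F)
    kept {F} wf with F a ∧ F b in ab∈F
    ... | false = s≤s z≤n
    ... | true  = let a∈F , b∈F = contains⁻ F ab∈F
                  in Any⇒1≤length (pieces-removeEdge-joining wf a∈F b∈F a⇝b)

  edgeOp-∋ : G a b ≡ true → Walk G′ allV a b → Any (λ K → a ∈ K × b ∈ K) (edgeOp G′ a b H)
  edgeOp-∋ gab a⇝b = Anyₚ.concatMap⁺ (edgeSplit G′ a b) (anyWithAll joining wellFormed (covers gab))
    where
    joining : ∀ {F} → WellFormed G F → a ∈ F × b ∈ F →
      Any (λ K → a ∈ K × b ∈ K) (edgeSplit G′ a b F)
    joining wf (a∈F , b∈F) rewrite a∈F | b∈F = pieces-removeEdge-joining wf a∈F b∈F a⇝b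

module _ {n} {G : Graph n} {H : Hypergraph n} {v : Fin n} (tracks : Tracks G H) where
  open Tracks tracks

  vertexOp-length-≥ : length H ≤ length (vertexOp G v H)
  vertexOp-length-≥ = length-concatMap-≥ (vertexSplit G v) (All.map (vertexSplit-≥1 symmetric) wellFormed)

  vertexOp-length-> : ∀ {a b} → Separates G v a b → Any (λ K → a ∈ K × b ∈ K) H →
    length H < length (vertexOp G v H)
  vertexOp-length-> sep K∋ab =
    length-concatMap-> (vertexSplit G v) (All.map (vertexSplit-≥1 symmetric) wellFormed)
      (anyWithAll (λ wf (a∈K , b∈K) → vertexSplit-≥2 symmetric sep wf a∈K b∈K) wellFormed K∋ab)

potential-bridge : ∀ {f f′ c c′} → f ≤ suc f′ → c < c′ → f + 2 * c + 1 ≤ f′ + 2 * c′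
potential-bridge {f} {f′} {c} {c′} f≤ c< = begin
  f + 2 * c + 1       ≤⟨ +-monoˡ-≤ 1 (+-monoˡ-≤ (2 * c) f≤) ⟩
  suc f′ + 2 * c + 1  ≡⟨ rearrange f′ c ⟩
  f′ + 2 * suc c      ≤⟨ +-monoʳ-≤ f′ (*-monoʳ-≤ 2 c<) ⟩
  f′ + 2 * c′         ∎
  where
  open ≤-Reasoning
  rearrange : ∀ f c → suc f + 2 * c + 1 ≡ f + 2 * suc c
  rearrange = solve-∀

potential-cycle : ∀ {f f′ c c′} → f < f′ → c ≤ c′ → f + 2 * c + 1 ≤ f′ + 2 * c′
potential-cycle {f} {f′} {c} {c′} f< c≤ = begin
  f + 2 * c + 1   ≡⟨ shift f c ⟩
  suc f + 2 * c   ≤⟨ +-mono-≤ f< (*-monoʳ-≤ 2 c≤) ⟩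
  f′ + 2 * c′     ∎
  where
  open ≤-Reasoning
  shift : ∀ f c → f + 2 * c + 1 ≡ suc f + 2 * c
  shift = solve-∀

module _ {n} {G : Graph n} {H : Hypergraph n} {a b v : Fin n}
         (tracks : Tracks G H) (gab : G a b ≡ true) (sep : Separates (removeEdge G a b) v a b) where

  private
    G′ = removeEdge G a b
    tracks₁ = tracks-edgeOp tracks a b
    tracks₂ = tracks-vertexOp tracks₁ v
    a≢b = separates-≢ sep
    G′⇒G : ∀ {u y} → Walk G′ allV u y → Walk G allV u y
    G′⇒G = walk-map (λ e → e) (λ _ _ → removeEdge-⊆ {G = G} {a} {b})
    components≡ = numComponents≡componentCount tracks
    components₂≡ = numComponents≡componentCount tracks₂

  step-potential : length H + 2 * numComponents H + 1
    ≤ length (vertexOp G′ v (edgeOp G′ a b H)) + 2 * numComponents (vertexOp G′ v (edgeOp G′ a b H))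
  step-potential with Walk? G′ allV a b
  ... | yes a⇝b = potential-cycle
    (≤-<-trans (edgeOp-length-≥ tracks a≢b a⇝b)
               (vertexOp-length-> tracks₁ sep (edgeOp-∋ tracks a≢b gab a⇝b)))
    (subst₂ _≤_ (sym components≡) (sym components₂≡) (componentCount-mono G′⇒G))
  ... | no a≁b = potential-bridge
    (≤-trans (edgeOp-length-≥-1 tracks a≢b) (s≤s (vertexOp-length-≥ tracks₁)))
    (subst₂ _<_ (sym components≡) (sym components₂≡)
      (componentCount-mono-< G′⇒G (Tracks.symmetric tracks) (Tracks.symmetric tracks₁)
                             (walk-edge refl refl gab) a≁b))

-- Erase processes

-- e was the only edge between V¹ and V², so in G ∖ e a walk can leave V¹ only through v.
leaves-side₁-through-v : ∀ {s t} {G : Graph (suc (s + t))} {st} → ErasableBy s t G st →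
  ∀ {S p y} → Walk (afterStep G st) S p y → part st p ≡ side₁ → part st y ≡ side₁ ⊎ v st ∈ S
leaves-side₁-through-v E (stay _) p₁ = inj₁ p₁
leaves-side₁-through-v {G = G} {st} E@(_ , _ , closed-is-v , _ , _ , _ , only) {S}
                       (extend {w} {y} p⇝w y∈S g) p₁
  with leaves-side₁-through-v E p⇝w p₁ | part st y in y-side
... | inj₂ v∈S | _          = inj₂ v∈S
... | inj₁ _   | side₁      = inj₁ refl
... | inj₁ _   | closedSide = inj₂ (subst (_∈ S) (closed-is-v y y-side) y∈S)
... | inj₁ w₁  | side₂      =
  contradiction (only w y (removeEdge-⊆ {G = G} g) w₁ y-side) (removeEdge-removed {G = G} g)

erasable⇒separates : ∀ {s t} {G : Graph (suc (s + t))} {st} → Symmetric G → ErasableBy s t G st →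
  Separates (afterStep G st) (v st) (a st) (b st)
erasable⇒separates {G = G} {st} symG E@(_ , v-closed , _ , _ , _ , sides , _) =
  not-closed (Sum.map proj₁ proj₂ sides) , not-closed (Sum.swap (Sum.map proj₂ proj₁ sides)) , through
  where
  not-closed : ∀ {x} → part st x ≡ side₁ ⊎ part st x ≡ side₂ → x ≢ v st
  not-closed (inj₁ x₁) refl = contradiction (trans (sym x₁) v-closed) λ ()
  not-closed (inj₂ x₂) refl = contradiction (trans (sym x₂) v-closed) λ ()
  crosses : ∀ {S p y} → Walk (afterStep G st) S p y → part st p ≡ side₁ → part st y ≡ side₂ →
    v st ∈ S
  crosses p⇝y p₁ y₂ with leaves-side₁-through-v E p⇝y p₁
  ... | inj₁ y₁  = contradiction (trans (sym y₁) y₂) λ ()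
  ... | inj₂ v∈S = v∈S
  through : ∀ {S} → Walk (afterStep G st) S (a st) (b st) → v st ∈ S
  through a⇝b = Sum.[ (λ (a₁ , b₂) → crosses a⇝b a₁ b₂)
                    , (λ (b₁ , a₂) → crosses (walk-sym (removeEdge-sym symG) a⇝b) b₁ a₂) ]′ sides

erasableBy-at : ∀ {s t} {G : Graph (suc (s + t))} pre {st post} →
  EraseProcess s t G (pre ++ st ∷ post) → ErasableBy s t (afterSteps G pre) st
erasableBy-at []        (E , _)    = E
erasableBy-at (_ ∷ pre) (_ , rest) = erasableBy-at pre rest

corollary1 : (s t : ℕ) → 1 ≤ s → 1 ≤ t →
    (G : Graph (suc (s + t))) → MaxErasable s t G →
    (sts : List (Step (suc (s + t)))) → EraseProcess s t G sts →
    (pre : List (Step (suc (s + t)))) (st : Step (suc (s + t))) (post : List (Step (suc (s + t)))) →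
    sts ≡ pre ++ (st ∷ post) →
      numEdges (hyperAfter G (H₀ G) pre) + 2 * numComponents (hyperAfter G (H₀ G) pre) + 1
        ≤ numEdges (hyperStep (afterSteps G pre) st (hyperAfter G (H₀ G) pre))
          + 2 * numComponents (hyperStep (afterSteps G pre) st (hyperAfter G (H₀ G) pre))
corollary1 s t _ _ G ((simple , _) , _) sts process pre st post refl =
  step-potential tracks (proj₁ E) (erasable⇒separates (Tracks.symmetric tracks) E)
  where
  tracks = tracks-hyperAfter (tracks-H₀ simple) pre
  E = erasableBy-at pre process
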